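{- Let $S\subset \mathbb{Z}^n$ be a realizable set, and let $S_1=\{x\in S: (x_1-1,\dots,x_n-1)\in S\}$ and $S_0=S\setminus S_1$. Then there exists a realization $(T,W)$ of $S$ with $T$ a tree if and only if both of the following hold: (i) for every $x,y\in S$ with $\max_{i\in[n]}|x_i-y_i|=1$, we have $x_j\neq y_j$ for every $j\in[n]$; (ii) for every $x\in S_0$ and every $j\in[n]$ with $x_j>0$, there exists exactly one $y\in S_0$ with $\max_{i\in[n]}|x_i-y_i|=1$ and $y_j=x_j-1$.
   Context: All graphs are finite, simple and connected. For a graph $G$ and an ordered vertex subset $W=\{\omega^1,\dots,\omega^n\}$, $r(u\mid W)=(d(u,\omega^1),\dots,d(u,\omega^n))$; $W$ is resolving if these vectors are pairwise distinct. A finite $S\subset\mathbb{Z}^n$ is realizable if there exist a graph $G$ and a resolving set $W$ with $S=\{r(u\mid W):u\in V(G)\}$; $(G,W)$ is then a realization of $S$. -}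

module Defs where

open import Data.Nat using (ℕ; zero; suc; _≤_; _⊔_)
open import Data.Integer as ℤ using (ℤ; +_; ∣_∣; _-_; _<_)
open import Data.Fin using (Fin; zero; suc; inject₁; fromℕ)
open import Data.Vec using (Vec; lookup; zipWith; foldr′; map)
open import Data.List using (List)
open import Data.List.Membership.Propositional using (_∈_)
open import Data.Bool using (Bool; true; false)
open import Data.Product using (Σ; ∃; ∃-syntax; _×_; _,_)
open import Relation.Binary.PropositionalEquality using (_≡_)
open import Relation.Nullary using (¬_)
open import Function.Definitions using (Injective)

data Walk {m : ℕ} (adj : Fin m → Fin m → Bool) : Fin m → Fin m → ℕ → Set where
  here : ∀ {u} → Walk adj u u 0
  step : ∀ {u v w k} → adj u v ≡ true → Walk adj v w k → Walk adj u w (suc k)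

record Graph : Set where
  field
    m         : ℕ
    nonempty  : 1 ≤ m
    adj       : Fin m → Fin m → Bool
    irrefl    : ∀ u → adj u u ≡ false
    sym       : ∀ u v → adj u v ≡ adj v u
    connected : ∀ u v → ∃[ k ] Walk adj u v k

open Graph public

Vertex : Graph → Set
Vertex G = Fin (m G)

Dist : (G : Graph) → Vertex G → Vertex G → ℕ → Set
Dist G u v k = Walk (adj G) u v k × (∀ j → Walk (adj G) u v j → k ≤ j)

-- A cycle: distinct vertices f 0, …, f (l-1) with l ≥ 3, consecutive
-- ones adjacent and f (l-1) adjacent to f 0.
HasCycle : Graph → Set
HasCycle G = ∃[ j ] Σ (Fin (suc (suc (suc j))) → Vertex G) λ f →
    Injective _≡_ _≡_ f
  × (∀ (i : Fin (suc (suc j))) → adj G (f (inject₁ i)) (f (suc i)) ≡ true)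
  × adj G (f (fromℕ (suc (suc j)))) (f zero) ≡ true

IsTree : Graph → Set
IsTree G = ¬ HasCycle G

-- W : an ordered vertex subset {ω¹,…,ωⁿ} (injective as it is a subset).
-- Rep G W u x  means  r(u | W) = x.
Rep : ∀ {n} (G : Graph) → (Fin n → Vertex G) → Vertex G → Vec ℤ n → Set
Rep G W u x = ∀ i → ∃[ k ] (lookup x i ≡ + k × Dist G u (W i) k)

Resolving : ∀ {n} (G : Graph) → (Fin n → Vertex G) → Set
Resolving G W = ∀ u v x → Rep G W u x → Rep G W v x → u ≡ v

-- (G , W) is a realization of the finite set S ⊂ ℤⁿ (given as a list):
-- W is a resolving ordered vertex subset and S = { r(u | W) : u ∈ V(G) }.
Realization : ∀ {n} (G : Graph) → (Fin n → Vertex G) → List (Vec ℤ n) → Set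
Realization G W S =
    Injective _≡_ _≡_ W
  × Resolving G W
  × (∀ u → ∃[ x ] (x ∈ S × Rep G W u x))
  × (∀ x → x ∈ S → ∃[ u ] Rep G W u x)

Realizable : ∀ {n} → List (Vec ℤ n) → Set
Realizable {n} S = ∃[ G ] Σ (Fin n → Vertex G) λ W → Realization G W S

-- max_{i ∈ [n]} |x_i - y_i|  (0 when n = 0)
dist∞ : ∀ {n} → Vec ℤ n → Vec ℤ n → ℕ
dist∞ x y = foldr′ _⊔_ 0 (zipWith (λ a b → ∣ a - b ∣) x y)

minusOne : ∀ {n} → Vec ℤ n → Vec ℤ n
minusOne x = map (λ a → a - + 1) x

InS₁ : ∀ {n} → List (Vec ℤ n) → Vec ℤ n → Set
InS₁ S x = x ∈ S × minusOne x ∈ S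

InS₀ : ∀ {n} → List (Vec ℤ n) → Vec ℤ n → Set
InS₀ S x = x ∈ S × ¬ InS₁ S x

CondI : ∀ {n} → List (Vec ℤ n) → Set
CondI {n} S = ∀ x y → x ∈ S → y ∈ S → dist∞ x y ≡ 1 →
  ∀ (j : Fin n) → ¬ (lookup x j ≡ lookup y j)

CondII : ∀ {n} → List (Vec ℤ n) → Set
CondII {n} S = ∀ x → InS₀ S x → ∀ (j : Fin n) → + 0 < lookup x j →
  ∃[ y ] ((InS₀ S y × dist∞ x y ≡ 1 × lookup y j ≡ lookup x j - + 1)
          × (∀ z → InS₀ S z → dist∞ x z ≡ 1 → lookup z j ≡ lookup x j - + 1 → z ≡ y))

-- Necessity. In a tree, neighbours have distances to any vertex w that
-- differ by exactly one (equal distances would close a cycle through the two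
-- geodesics to w), so the representations of neighbours are at ℓ∞-distance 1
-- and differ in every coordinate; and a tree is bipartite, so two vertices
-- that agree in one coordinate and are at ℓ∞-distance 1 agree in all, which
-- gives (i). For x = r(v | W) ∈ S₀ with xⱼ > 0, the vector required by (ii)
-- is that of the next vertex y on a geodesic from v to ωʲ: if it were in S₁,
-- or if another vertex had the required vector, then v would have a
-- neighbour one step closer to every landmark, i.e. x ∈ S₁.
--
-- Sufficiency. Keep the vertices and landmarks of a realization and join
-- each vertex u to a parent: the vertex representing x − 1 if x = r(u | W)
-- lies in S₁, and otherwise the vertex that (ii) provides for the first
-- coordinate. Parents are unique and one step closer to ω¹, so the new graph
-- has no cycle. Its edges change every landmark distance by at most one, and
-- by (ii), with (i) deciding which end of the edge is the parent, every
-- vertex has a neighbour one step closer to any given landmark; hence the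
-- new graph has the same distances to the landmarks and realizes S.

module Submission where

open import Defs hiding (sym)

open import Data.Bool using (Bool; true) renaming (_≟_ to _≟ᵇ_)
open import Data.Bool.Properties using (∨-comm)
open import Data.Empty using (⊥; ⊥-elim)
open import Data.Fin using (Fin; zero; suc; toℕ; inject₁; fromℕ; fromℕ<) renaming (_≟_ to _≟ᶠ_)
open import Data.Fin.Properties
  using (any?; toℕ-injective; toℕ<n; toℕ-inject₁; toℕ-fromℕ; fromℕ<-toℕ; toℕ-fromℕ<)
open import Data.Integer as ℤ using (ℤ; +_)
import Data.Integer.Properties as ℤ
open import Data.List using (List)
open import Data.List.Membership.Propositional using (_∈_)
import Data.List.Membership.DecPropositional as DecMembership
open import Data.Nat as ℕ using (ℕ; zero; suc; parity; _+_; _∸_; _≤_; _<_; _⊔_; z≤n; s≤s; _≤?_; ∣_-_∣)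
open import Data.Nat.GeneralisedArithmetic using (iterate)
open import Data.Nat.Induction using (<-wellFounded)
open import Data.Nat.Properties
import Data.Parity.Properties as ℙ
open import Data.Product using (Σ; ∃-syntax; _×_; _,_; proj₁; proj₂)
open import Data.Sum using (_⊎_; inj₁; inj₂; [_,_]′)
open import Data.Vec using (Vec; []; _∷_; lookup; tabulate)
open import Data.Vec.Properties using (lookup∘tabulate; lookup-map; ≡-dec)
open import Data.Vec.Relation.Binary.Pointwise.Extensional using (ext; Pointwise-≡⇒≡)
open import Function.Base using (_∘_)
open import Function.Bundles using (_⇔_; mk⇔; Equivalence)
open import Function.Definitions using (Injective)
open import Induction.WellFounded using (Acc; acc)
open import Relation.Binary.Definitions using (tri<; tri≈; tri>)
open import Relation.Binary.PropositionalEquality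
  using (_≡_; _≢_; refl; sym; trans; cong; cong₂; subst; subst₂)
open import Relation.Nullary using (¬_; Dec; yes; no; does)
open import Relation.Nullary.Decidable using (_×-dec_; _⊎-dec_; ¬?; dec-true; dec-false)
open import Relation.Unary using (Decidable)

least-witness : ∀ {p} {P : ℕ → Set p} → Decidable P → ∀ {n} → P n →
                ∃[ k ] P k × (∀ {j} → P j → k ≤ j)
least-witness {P = P} P? {n} Pn = search n Pn (<-wellFounded n)
  where
  search : ∀ n → P n → Acc _<_ n → ∃[ k ] P k × (∀ {j} → P j → k ≤ j)
  search n Pn (acc below) with anyUpTo? P? n
  ... | yes (j , j<n , Pj) = search j Pj (below j<n)
  ... | no none = n , Pn , λ Pj → ≮⇒≥ (λ j<n → none (_ , j<n , Pj))

does≡true⇒ : ∀ {a} {A : Set a} (a? : Dec A) → does a? ≡ true → A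
does≡true⇒ (yes a) _ = a

argmax : (f : ℕ → ℕ) (N : ℕ) → ∃[ m ] m ≤ N × (∀ {i} → i ≤ N → f i ≤ f m)
argmax f zero = 0 , z≤n , λ { z≤n → ≤-refl }
argmax f (suc N) with argmax f N
... | m , m≤N , below with f (suc N) ≤? f m
...   | yes top≤ = m , ≤-trans m≤N (n≤1+n N) ,
                   λ i≤ → [ below ∘ ≤-pred , (λ { refl → top≤ }) ]′ (m≤n⇒m<n∨m≡n i≤)
...   | no top≰  = suc N , ≤-refl ,
                   λ i≤ → [ (λ i≤N → ≤-trans (below (≤-pred i≤N)) (<⇒≤ (≰⇒> top≰))) , (λ { refl → ≤-refl }) ]′
                            (m≤n⇒m<n∨m≡n i≤)

∣1+m-m∣≡1 : ∀ m → ∣ suc m - m ∣ ≡ 1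
∣1+m-m∣≡1 m = trans (m≤n⇒∣n-m∣≡n∸m (n≤1+n m)) (m+n∸n≡m 1 m)

∣m-n∣≤1⇒m≤1+n : ∀ {m n} → ∣ m - n ∣ ≤ 1 → m ≤ suc n
∣m-n∣≤1⇒m≤1+n {m} {n} le = ≤-trans (m≤∣m-n∣+n m n) (+-monoˡ-≤ n le)

∣m-n∣≤1⇒adjacent : ∀ {m n} → ∣ m - n ∣ ≤ 1 → m ≢ n → m ≡ suc n ⊎ n ≡ suc m
∣m-n∣≤1⇒adjacent {m} {n} le m≢n with <-cmp m n
... | tri< m<n _ _ = inj₂ (≤-antisym (∣m-n∣≤1⇒m≤1+n (subst (_≤ 1) (∣-∣-comm m n) le)) m<n)
... | tri≈ _ m≡n _ = ⊥-elim (m≢n m≡n)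
... | tri> _ _ n<m = inj₁ (≤-antisym (∣m-n∣≤1⇒m≤1+n le) n<m)

∣m-n∣≤1∧parity⇒≡ : ∀ {m n} → ∣ m - n ∣ ≤ 1 → parity m ≡ parity n → m ≡ n
∣m-n∣≤1∧parity⇒≡ {m} {n} le same-parity with m ≟ n
... | yes m≡n = m≡n
... | no m≢n with ∣m-n∣≤1⇒adjacent le m≢n
...   | inj₁ refl = ⊥-elim (ℙ.p≢p⁻¹ (parity (suc n)) (trans same-parity (sym (ℙ.suc-homo-⁻¹ n))))
...   | inj₂ refl = ⊥-elim (ℙ.p≢p⁻¹ (parity (suc m)) (trans (sym same-parity) (sym (ℙ.suc-homo-⁻¹ m))))

parity-cancelʳ : ∀ {m n} o → parity (m + o) ≡ parity (n + o) → parity m ≡ parity n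
parity-cancelʳ {m} {n} o eq =
  ℙ.+-cancelʳ-≡ (parity o) (parity m) (parity n) (trans (sym (ℙ.+-homo-+ m o)) (trans eq (ℙ.+-homo-+ n o)))

adjacent⇒∣m-n∣≡1 : ∀ {m n} → m ≡ suc n ⊎ n ≡ suc m → ∣ m - n ∣ ≡ 1
adjacent⇒∣m-n∣≡1 {n = n} (inj₁ refl) = ∣1+m-m∣≡1 n
adjacent⇒∣m-n∣≡1 {m = m} (inj₂ refl) = trans (∣-∣-comm m (suc m)) (∣1+m-m∣≡1 m)

∣+m-+n∣≡∣m-n∣ : ∀ m n → ℤ.∣ + m ℤ.- + n ∣ ≡ ∣ m - n ∣
∣+m-+n∣≡∣m-n∣ m n with ≤-total m n
... | inj₁ m≤n = trans (cong ℤ.∣_∣ (ℤ.m-n≡m⊖n m n))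
                   (trans (ℤ.∣⊖∣-≤ m≤n) (sym (m≤n⇒∣m-n∣≡n∸m m≤n)))
... | inj₂ n≤m = trans (cong ℤ.∣_∣ (ℤ.m-n≡m⊖n m n))
                   (trans (ℤ.∣m⊖n∣≡∣n⊖m∣ m n) (trans (ℤ.∣⊖∣-≤ n≤m) (sym (m≤n⇒∣n-m∣≡n∸m n≤m))))

+[1+n]-1≡+n : ∀ n → + suc n ℤ.- + 1 ≡ + n
+[1+n]-1≡+n n = trans (ℤ.m-n≡m⊖n (suc n) 1) (ℤ.⊖-≥ (s≤s z≤n))

+m≡+n-1⇒n≡1+m : ∀ {m} n → + m ≡ + n ℤ.- + 1 → n ≡ suc m
+m≡+n-1⇒n≡1+m zero    ()
+m≡+n-1⇒n≡1+m (suc n) eq = cong suc (sym (ℤ.+-injective (trans eq (+[1+n]-1≡+n n))))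

coordinate≤dist∞ : ∀ {n} (x y : Vec ℤ n) → ∀ i → ℤ.∣ lookup x i ℤ.- lookup y i ∣ ≤ dist∞ x y
coordinate≤dist∞ (a ∷ x) (b ∷ y) zero    = m≤m⊔n _ _
coordinate≤dist∞ (a ∷ x) (b ∷ y) (suc i) = ≤-trans (coordinate≤dist∞ x y i) (m≤n⊔m _ _)

dist∞≤ : ∀ {n} (x y : Vec ℤ n) {k} → (∀ i → ℤ.∣ lookup x i ℤ.- lookup y i ∣ ≤ k) → dist∞ x y ≤ k
dist∞≤ []      []      _     = z≤n
dist∞≤ (a ∷ x) (b ∷ y) bound = ⊔-lub (bound zero) (dist∞≤ x y (bound ∘ suc))

dist∞-sym : ∀ {n} (x y : Vec ℤ n) → dist∞ x y ≡ dist∞ y x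
dist∞-sym []      []      = refl
dist∞-sym (a ∷ x) (b ∷ y) = cong₂ _⊔_ (ℤ.∣i-j∣≡∣j-i∣ a b) (dist∞-sym x y)

dist∞-self : ∀ {n} (x : Vec ℤ n) → dist∞ x x ≡ 0
dist∞-self x = n≤0⇒n≡0 (dist∞≤ x x (λ i → ≤-reflexive (cong ℤ.∣_∣ (ℤ.+-inverseʳ (lookup x i)))))

module _ {m : ℕ} {A : Fin m → Fin m → Bool} where

  _++ʷ_ : ∀ {u v w k l} → Walk A u v k → Walk A v w l → Walk A u w (k + l)
  here       ++ʷ q = q
  step e p   ++ʷ q = step e (p ++ʷ q)

  reverseʷ : (∀ u v → A u v ≡ A v u) → ∀ {u v k} → Walk A u v k → Walk A v u k
  reverseʷ A-sym here       = here
  reverseʷ A-sym (step {u} {v} e p) =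
    subst (Walk A _ _) (+-comm _ 1) (reverseʷ A-sym p ++ʷ step (trans (A-sym v u) e) here)

  walk? : ∀ u v k → Dec (Walk A u v k)
  walk? u v zero with u ≟ᶠ v
  ... | yes refl = yes here
  ... | no u≢v   = no λ { here → u≢v refl }
  walk? u v (suc k) with any? (λ w → (A u w ≟ᵇ true) ×-dec walk? w v k)
  ... | yes (w , e , p) = yes (step e p)
  ... | no none         = no λ { (step e p) → none (_ , e , p) }

module GraphProperties (G : Graph) where

  private
    V : Set
    V = Vertex G

  infix 4 _~_
  _~_ : V → V → Set
  u ~ v = adj G u v ≡ true

  ~-sym : ∀ {u v} → u ~ v → v ~ u
  ~-sym {u} {v} e = trans (Graph.sym G v u) e

  ~-irrefl : ∀ {u} → ¬ u ~ u
  ~-irrefl {u} e with trans (sym e) (irrefl G u)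
  ... | ()

  -- Opaque, so that d u v stays rigid during unification.
  opaque
    private
      shortest : ∀ u v → ∃[ k ] Walk (adj G) u v k × (∀ {j} → Walk (adj G) u v j → k ≤ j)
      shortest u v = least-witness (walk? u v) (proj₂ (connected G u v))

    d : V → V → ℕ
    d u v = proj₁ (shortest u v)

    d-walk : ∀ u v → Walk (adj G) u v (d u v)
    d-walk u v = proj₁ (proj₂ (shortest u v))

    d-minimal : ∀ {u v k} → Walk (adj G) u v k → d u v ≤ k
    d-minimal = proj₂ (proj₂ (shortest _ _))

  d-Dist : ∀ u v → Dist G u v (d u v)
  d-Dist u v = d-walk u v , λ _ → d-minimal

  Dist-unique : ∀ {u v k l} → Dist G u v k → Dist G u v l → k ≡ l
  Dist-unique (p , p-min) (q , q-min) = ≤-antisym (p-min _ q) (q-min _ p)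

  Dist⇒d : ∀ {u v k} → Dist G u v k → d u v ≡ k
  Dist⇒d = Dist-unique (d-Dist _ _)

  d-sym : ∀ u v → d u v ≡ d v u
  d-sym u v = ≤-antisym (d-minimal (reverseʷ (Graph.sym G) (d-walk v u)))
                        (d-minimal (reverseʷ (Graph.sym G) (d-walk u v)))

  d-self : ∀ u → d u u ≡ 0
  d-self u = n≤0⇒n≡0 (d-minimal here)

  d≡0⇒≡ : ∀ {u v} → d u v ≡ 0 → u ≡ v
  d≡0⇒≡ {u} {v} eq with d u v | d-walk u v
  d≡0⇒≡ refl | zero | here = refl

  d-triangle : ∀ u v w → d u w ≤ d u v + d v w
  d-triangle u v w = d-minimal (d-walk u v ++ʷ d-walk v w)

  d-adjacent : ∀ {u v} w → u ~ v → d u w ≤ suc (d v w)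
  d-adjacent w e = d-minimal (step e (d-walk _ w))

  private
    first : ∀ {u v k} → Walk (adj G) u v k → V
    first {u} here           = u
    first (step {v = v} _ _) = v

  -- The next vertex on a shortest walk from u to w; u itself when u = w.
  toward : V → V → V
  toward w u = first (d-walk u w)

  toward-step : ∀ {w u} → 0 < d u w → u ~ toward w u × d u w ≡ suc (d (toward w u) w)
  toward-step {w} {u} = go (d-walk u w) refl
    where
    go : ∀ {k} (p : Walk (adj G) u w k) → d u w ≡ k → 0 < k →
         u ~ first p × d u w ≡ suc (d (first p) w)
    go (step {v = v} e p) eq _ = e , ≤-antisym (d-adjacent w e) (subst (suc (d v w) ≤_) (sym eq) (s≤s (d-minimal p)))

  d≡1⇒~ : ∀ {u v} → d u v ≡ 1 → u ~ v
  d≡1⇒~ {u} {v} uv = subst (u ~_) (d≡0⇒≡ (suc-injective (trans (sym (proj₂ first-step)) uv))) (proj₁ first-step)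
    where
    first-step : u ~ toward v u × d u v ≡ suc (d (toward v u) v)
    first-step = toward-step (subst (0 <_) (sym uv) (s≤s z≤n))

  record Path (a b : V) (N : ℕ) : Set where
    field
      vertex    : ℕ → V
      start     : vertex 0 ≡ a
      end       : vertex N ≡ b
      adjacent  : ∀ {i} → i < N → vertex i ~ vertex (suc i)
      injective : ∀ {i j} → i ≤ N → j ≤ N → vertex i ≡ vertex j → i ≡ j

  ClosedPath : Set
  ClosedPath = ∃[ a ] ∃[ b ] ∃[ N ] 2 ≤ N × Path a b N × b ~ a

  HasCycle⇒ClosedPath : HasCycle G → ClosedPath
  HasCycle⇒ClosedPath (j , f , f-inj , f-adj , f-close) =
    f zero , f (fromℕ (2 + j)) , 2 + j , s≤s (s≤s z≤n) , path , f-close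
    where
    vertex : ℕ → V
    vertex i with i ≤? 2 + j
    ... | yes i≤ = f (fromℕ< (s≤s i≤))
    ... | no _   = f zero
    vertex-toℕ : ∀ x → vertex (toℕ x) ≡ f x
    vertex-toℕ x with toℕ x ≤? 2 + j
    ... | yes i≤ = cong f (fromℕ<-toℕ x (s≤s i≤))
    ... | no i≰  = ⊥-elim (i≰ (≤-pred (toℕ<n x)))
    vertex-fromℕ< : ∀ {i} (i< : i < 3 + j) → vertex i ≡ f (fromℕ< i<)
    vertex-fromℕ< i< = trans (cong vertex (sym (toℕ-fromℕ< i<))) (vertex-toℕ _)
    path : Path (f zero) (f (fromℕ (2 + j))) (2 + j)
    path = record
      { vertex    = vertex
      ; start     = vertex-toℕ zero
      ; end       = trans (cong vertex (sym (toℕ-fromℕ (2 + j)))) (vertex-toℕ _)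
      ; adjacent  = λ {i} i< → subst₂ _~_
          (sym (trans (cong vertex (sym (trans (toℕ-inject₁ (fromℕ< i<)) (toℕ-fromℕ< i<)))) (vertex-toℕ _)))
          (sym (vertex-fromℕ< (s≤s i<)))
          (f-adj (fromℕ< i<))
      ; injective = λ i≤ j≤ eq → trans (sym (toℕ-fromℕ< (s≤s i≤)))
          (trans (cong toℕ (f-inj (trans (sym (vertex-fromℕ< (s≤s i≤))) (trans eq (vertex-fromℕ< (s≤s j≤))))))
                 (toℕ-fromℕ< (s≤s j≤)))
      }

  ClosedPath⇒HasCycle : ClosedPath → HasCycle G
  ClosedPath⇒HasCycle (a , b , suc (suc j) , s≤s (s≤s z≤n) , P , b~a) = j , f , f-inj , f-adj , f-close
    where
    open Path P
    f : Fin (3 + j) → V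
    f x = vertex (toℕ x)
    f-inj : Injective _≡_ _≡_ f
    f-inj {x} {y} eq = toℕ-injective (injective (≤-pred (toℕ<n x)) (≤-pred (toℕ<n y)) eq)
    f-adj : ∀ i → f (inject₁ i) ~ f (suc i)
    f-adj i = subst (λ k → vertex k ~ vertex (suc (toℕ i))) (sym (toℕ-inject₁ i)) (adjacent (toℕ<n i))
    f-close : f (fromℕ (2 + j)) ~ f zero
    f-close = subst₂ _~_ (trans (sym end) (cong vertex (sym (toℕ-fromℕ (2 + j))))) (sym start) b~a

  closedPath-neighbours : ∀ {a b N} → 2 ≤ N → (P : Path a b N) → b ~ a → ∀ {m} → m ≤ N →
    let open Path P in
    ∃[ x ] ∃[ y ] x ≤ N × y ≤ N × x ≢ y × vertex m ~ vertex x × vertex m ~ vertex y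
  closedPath-neighbours {N = N} 2≤N P b~a {zero} _ =
    1 , N , 1≤N , ≤-refl , (λ 1≡N → <⇒≢ 2≤N 1≡N) , adjacent 1≤N ,
    subst₂ _~_ (sym start) (sym end) (~-sym b~a)
    where
    open Path P
    1≤N : 1 ≤ N
    1≤N = ≤-trans (n≤1+n 1) 2≤N
  closedPath-neighbours {N = N} 2≤N P b~a {suc m} m<N with m≤n⇒m<n∨m≡n m<N
  ... | inj₁ 1+m<N = m , suc (suc m) , ≤-trans (n≤1+n m) m<N , 1+m<N , (λ ()) ,
                     ~-sym (Path.adjacent P m<N) , Path.adjacent P 1+m<N
  ... | inj₂ refl  = m , 0 , ≤-trans (n≤1+n m) m<N , z≤n , (λ { refl → <-irrefl refl 2≤N }) ,
                     ~-sym (Path.adjacent P ≤-refl) , subst₂ _~_ (sym (Path.end P)) (sym (Path.start P)) b~a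

  extendPath : ∀ {a b y N} (P : Path a b N) → b ~ y →
               (∀ {i} → i ≤ N → Path.vertex P i ≢ y) → Path a y (suc N)
  extendPath {a} {b} {y} {N} P b~y fresh = record
    { vertex    = vertex′
    ; start     = trans (old z≤n) start
    ; end       = new ≤-refl
    ; adjacent  = adjacent′
    ; injective = injective′
    }
    where
    open Path P
    vertex′ : ℕ → V
    vertex′ i with i ≤? N
    ... | yes _ = vertex i
    ... | no _  = y
    old : ∀ {i} → i ≤ N → vertex′ i ≡ vertex i
    old {i} i≤N with i ≤? N
    ... | yes _  = refl
    ... | no i≰N = ⊥-elim (i≰N i≤N)
    new : ∀ {i} → N < i → vertex′ i ≡ y
    new {i} N<i with i ≤? N
    ... | yes i≤N = ⊥-elim (<⇒≱ N<i i≤N)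
    ... | no _    = refl
    adjacent′ : ∀ {i} → i < suc N → vertex′ i ~ vertex′ (suc i)
    adjacent′ {i} (s≤s i≤N) with <-cmp i N
    ... | tri< i<N _ _ = subst₂ _~_ (sym (old i≤N)) (sym (old i<N)) (adjacent i<N)
    ... | tri≈ _ refl _ = subst₂ _~_ (sym (trans (old i≤N) end)) (sym (new ≤-refl)) b~y
    ... | tri> _ _ N<i = ⊥-elim (<⇒≱ N<i i≤N)
    injective′ : ∀ {i j} → i ≤ suc N → j ≤ suc N → vertex′ i ≡ vertex′ j → i ≡ j
    injective′ {i} {j} i≤ j≤ eq with i ≤? N | j ≤? N
    ... | yes i≤N | yes j≤N = injective i≤N j≤N eq
    ... | yes i≤N | no _    = ⊥-elim (fresh i≤N eq)
    ... | no _    | yes j≤N = ⊥-elim (fresh j≤N (sym eq))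
    ... | no i≰N  | no j≰N  = trans (≤-antisym i≤ (≰⇒> i≰N)) (sym (≤-antisym j≤ (≰⇒> j≰N)))

  geodesic : V → V → ℕ → V
  geodesic w = iterate (toward w)

  d-geodesic : ∀ w a {i} → i ≤ d a w → d (geodesic w a i) w ≡ d a w ∸ i
  d-geodesic w a {zero}  _   = refl
  d-geodesic w a {suc i} i<d with toward-step {w} {a} (≤-trans (s≤s z≤n) i<d)
  ... | _ , eq = trans (d-geodesic w (toward w a) (≤-pred (subst (suc i ≤_) eq i<d))) (cong (_∸ suc i) (sym eq))

  geodesic-adjacent : ∀ w a {i} → i < d a w → geodesic w a i ~ geodesic w a (suc i)
  geodesic-adjacent w a {zero}  0<d = proj₁ (toward-step 0<d)
  geodesic-adjacent w a {suc i} i<d with toward-step {w} {a} (≤-trans (s≤s z≤n) i<d)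
  ... | _ , eq = geodesic-adjacent w (toward w a) (≤-pred (subst (suc (suc i) ≤_) eq i<d))

  -- Follow the geodesic from a towards w up to the first vertex it shares
  -- with the geodesic from b (at the same index, as both start at the same
  -- distance from w), then walk back along the latter.
  private
    module JoinGeodesics {w a b : V} (a≢b : a ≢ b) (same : d a w ≡ d b w) where

      k : ℕ
      k = d a w

      P Q : ℕ → V
      P = geodesic w a
      Q = geodesic w b

      dP : ∀ {i} → i ≤ k → d (P i) w ≡ k ∸ i
      dP = d-geodesic w a

      dQ : ∀ {i} → i ≤ k → d (Q i) w ≡ k ∸ i
      dQ {i} i≤k = trans (d-geodesic w b (subst (i ≤_) same i≤k)) (cong (_∸ i) (sym same))

      index : ∀ {x y i j} → i ≤ k → j ≤ k → d x w ≡ k ∸ i → d y w ≡ k ∸ j → x ≡ y → i ≡ j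
      index i≤k j≤k dx dy refl = ∸-cancelˡ-≡ i≤k j≤k (trans (sym dx) dy)

      reach-w : ∀ {x} → d x w ≡ k ∸ k → x ≡ w
      reach-w dx = d≡0⇒≡ (trans dx (n∸n≡0 k))

      Pk≡Qk : P k ≡ Q k
      Pk≡Qk = trans (reach-w (dP ≤-refl)) (sym (reach-w (dQ ≤-refl)))

      meet : ∃[ t ] P t ≡ Q t × (∀ {j} → P j ≡ Q j → t ≤ j)
      meet = least-witness (λ i → P i ≟ᶠ Q i) {k} Pk≡Qk

      t : ℕ
      t = proj₁ meet

      Pt≡Qt : P t ≡ Q t
      Pt≡Qt = proj₁ (proj₂ meet)

      t≤k : t ≤ k
      t≤k = proj₂ (proj₂ meet) Pk≡Qk

      1≤t : 1 ≤ t
      1≤t with t | Pt≡Qt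
      ... | zero  | a≡b = ⊥-elim (a≢b a≡b)
      ... | suc _ | _   = s≤s z≤n

      mirror : ∀ {i} → t ≤ i → t + t ∸ i ≤ t
      mirror {i} t≤i = subst (t + t ∸ i ≤_) (m+n∸n≡m t t) (∸-monoʳ-≤ (t + t) t≤i)

      ≤t⇒≤k : ∀ {i} → i ≤ t → i ≤ k
      ≤t⇒≤k i≤t = ≤-trans i≤t t≤k

      mirror≤k : ∀ {i} → t ≤ i → t + t ∸ i ≤ k
      mirror≤k = ≤t⇒≤k ∘ mirror

      vertex : ℕ → V
      vertex i with i ≤? t
      ... | yes _ = P i
      ... | no _  = Q (t + t ∸ i)

      vertex-P : ∀ {i} → i ≤ t → vertex i ≡ P i
      vertex-P {i} i≤t with i ≤? t
      ... | yes _  = refl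
      ... | no i≰t = ⊥-elim (i≰t i≤t)

      vertex-Q : ∀ {i} → t ≤ i → vertex i ≡ Q (t + t ∸ i)
      vertex-Q {i} t≤i with i ≤? t
      ... | no _    = refl
      ... | yes i≤t with ≤-antisym i≤t t≤i
      ...   | refl  = trans Pt≡Qt (cong Q (sym (m+n∸n≡m t t)))

      adjacent : ∀ {i} → i < t + t → vertex i ~ vertex (suc i)
      adjacent {i} i<2t with <-≤-connex i t
      ... | inj₁ i<t = subst₂ _~_ (sym (vertex-P (<⇒≤ i<t))) (sym (vertex-P i<t))
                         (geodesic-adjacent w a (≤-trans i<t t≤k))
      ... | inj₂ t≤i = subst₂ _~_ (sym (trans (vertex-Q t≤i) (cong Q 2t-i))) (sym (vertex-Q (≤-trans t≤i (n≤1+n i))))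
                         (~-sym (geodesic-adjacent w b (subst (_≤ d b w) 2t-i (subst (t + t ∸ i ≤_) same (mirror≤k t≤i)))))
        where
        2t-i : t + t ∸ i ≡ suc (t + t ∸ suc i)
        2t-i = +-∸-assoc 1 i<2t

      -- A vertex shared by the two halves can only be the meeting point, by minimality of t.
      cross : ∀ {i j} → i ≤ t → t ≤ j → j ≤ t + t → P i ≡ Q (t + t ∸ j) → i ≡ j
      cross {i} {j} i≤t t≤j j≤ eq = trans i≡t (sym j≡t)
        where
        s≤t : t + t ∸ j ≤ t
        s≤t = mirror t≤j
        i≡s : i ≡ t + t ∸ j
        i≡s = index (≤t⇒≤k i≤t) (≤t⇒≤k s≤t) (dP (≤t⇒≤k i≤t)) (dQ (≤t⇒≤k s≤t)) eq
        s≡t : t + t ∸ j ≡ t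
        s≡t = ≤-antisym s≤t (proj₂ (proj₂ meet) (subst (λ x → P x ≡ Q (t + t ∸ j)) i≡s eq))
        i≡t : i ≡ t
        i≡t = trans i≡s s≡t
        j≡t : j ≡ t
        j≡t = ∸-cancelˡ-≡ j≤ (m≤n+m t t) (trans s≡t (sym (m+n∸n≡m t t)))

      injective : ∀ {i j} → i ≤ t + t → j ≤ t + t → vertex i ≡ vertex j → i ≡ j
      injective {i} {j} i≤ j≤ eq with ≤-total i t | ≤-total j t
      ... | inj₁ i≤t | inj₁ j≤t = index (≤t⇒≤k i≤t) (≤t⇒≤k j≤t) (dP (≤t⇒≤k i≤t)) (dP (≤t⇒≤k j≤t))
                                    (trans (sym (vertex-P i≤t)) (trans eq (vertex-P j≤t)))
      ... | inj₁ i≤t | inj₂ t≤j = cross i≤t t≤j j≤ (trans (sym (vertex-P i≤t)) (trans eq (vertex-Q t≤j)))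
      ... | inj₂ t≤i | inj₁ j≤t =
        sym (cross j≤t t≤i i≤ (trans (sym (vertex-P j≤t)) (trans (sym eq) (vertex-Q t≤i))))
      ... | inj₂ t≤i | inj₂ t≤j = ∸-cancelˡ-≡ i≤ j≤ (index (mirror≤k t≤i) (mirror≤k t≤j)
                                    (dQ (mirror≤k t≤i)) (dQ (mirror≤k t≤j))
                                    (trans (sym (vertex-Q t≤i)) (trans eq (vertex-Q t≤j))))

      path : Path a b (t + t)
      path = record
        { vertex = vertex ; start = vertex-P z≤n ; adjacent = adjacent ; injective = injective
        ; end = trans (vertex-Q (m≤m+n t t)) (cong Q (n∸n≡0 (t + t))) }

      bounded : ∀ {i} → i ≤ t + t → d (vertex i) w ≤ k
      bounded {i} _ with ≤-total i t
      ... | inj₁ i≤t = subst (_≤ k) (sym (trans (cong (λ x → d x w) (vertex-P i≤t)) (dP (≤t⇒≤k i≤t))))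
                         (m∸n≤m k i)
      ... | inj₂ t≤i = subst (_≤ k) (sym (trans (cong (λ x → d x w) (vertex-Q t≤i)) (dQ (mirror≤k t≤i))))
                         (m∸n≤m k (t + t ∸ i))

  join-geodesics : ∀ {w a b} → a ≢ b → d a w ≡ d b w →
    ∃[ N ] 2 ≤ N × Σ (Path a b N) λ P → ∀ {i} → i ≤ N → d (Path.vertex P i) w ≤ d a w
  join-geodesics a≢b same = t + t , +-mono-≤ 1≤t 1≤t , path , bounded
    where open JoinGeodesics a≢b same

  -- On a cycle, a vertex of maximal rank would have two parents.
  ranked-parents⇒IsTree : ∀ {ℓ} (Parent : V → V → Set ℓ) (rank : V → ℕ) →
    (∀ {u v} → u ~ v → Parent u v ⊎ Parent v u) →
    (∀ {u p} → Parent u p → rank p < rank u) →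
    (∀ {u p q} → Parent u p → Parent u q → p ≡ q) →
    IsTree G
  ranked-parents⇒IsTree Parent rank edge-parent parent-rank parent-unique cycle
    with HasCycle⇒ClosedPath cycle
  ... | a , b , N , 2≤N , P , b~a with argmax (rank ∘ Path.vertex P) N
  ...   | m , m≤N , maximal with closedPath-neighbours 2≤N P b~a m≤N
  ...     | x , y , x≤N , y≤N , x≢y , m~x , m~y =
    x≢y (Path.injective P x≤N y≤N (parent-unique (parent x≤N m~x) (parent y≤N m~y)))
    where
    parent : ∀ {x} → x ≤ N → Path.vertex P m ~ Path.vertex P x → Parent (Path.vertex P m) (Path.vertex P x)
    parent x≤N m~x with edge-parent m~x
    ... | inj₁ up   = up
    ... | inj₂ down = ⊥-elim (<⇒≱ (parent-rank down) (maximal x≤N))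

module TreeDistance (G : Graph) (tree : IsTree G) where

  open GraphProperties G

  private
    no-closed-path : ¬ ClosedPath
    no-closed-path = tree ∘ ClosedPath⇒HasCycle

  adjacent⇒d≢ : ∀ {u v} w → u ~ v → d u w ≢ d v w
  adjacent⇒d≢ {u} {v} w u~v same with join-geodesics (λ { refl → ~-irrefl u~v }) same
  ... | N , 2≤N , P , _ = no-closed-path (u , v , N , 2≤N , P , ~-sym u~v)

  adjacent-d : ∀ {u v} w → u ~ v → d u w ≡ suc (d v w) ⊎ d v w ≡ suc (d u w)
  adjacent-d {u} {v} w u~v with <-cmp (d u w) (d v w)
  ... | tri< u<v _ _ = inj₂ (≤-antisym (d-adjacent w (~-sym u~v)) u<v)
  ... | tri≈ _ u≡v _ = ⊥-elim (adjacent⇒d≢ w u~v u≡v)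
  ... | tri> _ _ v<u = inj₁ (≤-antisym (d-adjacent w u~v) v<u)

  adjacent-closer : ∀ {u v} w → u ~ v → d v w < d u w → d u w ≡ suc (d v w)
  adjacent-closer w u~v v<u with adjacent-d w u~v
  ... | inj₁ eq = eq
  ... | inj₂ eq = ⊥-elim (<-asym v<u (subst (_ <_) (sym eq) ≤-refl))

  -- A path between the two closer neighbours, followed by y, would close a cycle.
  closer-neighbour-unique : ∀ {y a b} w → y ~ a → y ~ b →
                            d y w ≡ suc (d a w) → d y w ≡ suc (d b w) → a ≡ b
  closer-neighbour-unique {y} {a} {b} w y~a y~b ya yb with a ≟ᶠ b
  ... | yes a≡b = a≡b
  ... | no a≢b with join-geodesics a≢b (suc-injective (trans (sym ya) yb))
  ...   | N , 2≤N , P , bounded =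
    ⊥-elim (no-closed-path (a , y , suc N , ≤-trans 2≤N (n≤1+n N) , extendPath P (~-sym y~b) fresh , y~a))
    where
    fresh : ∀ {i} → i ≤ N → Path.vertex P i ≢ y
    fresh i≤N refl = 1+n≰n (subst (_≤ d a w) ya (bounded i≤N))

  parity-walk : ∀ {a b ℓ} w → Walk (adj G) a b ℓ → parity (ℓ + d a w) ≡ parity (d b w)
  parity-walk w here = refl
  parity-walk {a} {ℓ = suc ℓ} w (step {v = a′} a~a′ p) with adjacent-d w a~a′
  ... | inj₁ eq = trans (cong parity (trans (cong (λ x → suc ℓ + x) eq) (+-suc (suc ℓ) (d a′ w)))) (parity-walk w p)
  ... | inj₂ eq = trans (cong parity (sym (trans (cong (λ x → ℓ + x) eq) (+-suc ℓ (d a w))))) (parity-walk w p)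

  -- Trees are bipartite.
  parity-d : ∀ u x y → parity (d u x + d u y) ≡ parity (d x y)
  parity-d u x y = parity-walk y (d-walk u x)

  -- Stepping from z towards p, on p's side of an edge pq that points
  -- towards w, never moves closer to w: otherwise the next vertex z′ would
  -- have two neighbours closer to w, namely z and the next vertex towards p
  -- (which is q if z′ = p).
  beyond-edge-step : ∀ {p q w z z′} → p ~ q → d q w < d p w → z ~ z′ → d z p ≡ suc (d z′ p) →
                     d z p < d z q → d z′ p + d p w ≤ d z′ w → d z w ≡ suc (d z′ w)
  beyond-edge-step {p} {q} {w} {z} {z′} p~q q<p z~z′ z-z′ zp<zq z′-far with adjacent-d w z~z′
  ... | inj₁ z-closer = z-closer
  ... | inj₂ z′-z = ⊥-elim (second-closer-neighbour (d z′ p) refl)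
    where
    second-closer-neighbour : ∀ m → d z′ p ≡ m → ⊥
    second-closer-neighbour zero z′p =
      <⇒≱ zp<zq (subst (_≤ d z p) (sym (trans (cong (λ x → d x q) z≡q) (d-self q))) z≤n)
      where
      z′≡p : z′ ≡ p
      z′≡p = d≡0⇒≡ z′p
      z≡q : z ≡ q
      z≡q = closer-neighbour-unique w (~-sym z~z′) (subst (_~ q) (sym z′≡p) p~q) z′-z
              (trans (cong (λ x → d x w) z′≡p) (adjacent-closer w p~q q<p))
    second-closer-neighbour (suc m) z′p =
      m≢1+n+m m (trans (sym cp) (trans (cong (λ x → d x p) (sym z≡c)) (trans z-z′ (cong suc z′p))))
      where
      c : Vertex G
      c = toward p z′
      c-step : z′ ~ c × d z′ p ≡ suc (d c p)
      c-step = toward-step (subst (0 <_) (sym z′p) (s≤s z≤n))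
      cp : d c p ≡ m
      cp = suc-injective (trans (sym (proj₂ c-step)) z′p)
      c<z′ : d c w < d z′ w
      c<z′ = ≤-trans (s≤s (≤-trans (d-triangle c p w) (≤-reflexive (cong (_+ d p w) cp))))
                     (subst (λ x → x + d p w ≤ d z′ w) z′p z′-far)
      z≡c : z ≡ c
      z≡c = closer-neighbour-unique w (~-sym z~z′) (proj₁ c-step) z′-z (adjacent-closer w (proj₁ c-step) c<z′)

  beyond-edge : ∀ {p q w} → p ~ q → d q w < d p w →
                ∀ {z} → d z p < d z q → d z p + d p w ≤ d z w
  beyond-edge {p} {q} {w} p~q q<p {z} = go (d z p) refl
    where
    go : ∀ {z} ℓ → d z p ≡ ℓ → d z p < d z q → ℓ + d p w ≤ d z w
    go zero    zp _ = ≤-reflexive (cong (λ x → d x w) (sym (d≡0⇒≡ zp)))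
    go {z} (suc ℓ) zp zp<zq = subst (suc ℓ + d p w ≤_) (sym z-z′) (s≤s z′-far)
      where
      z′ : Vertex G
      z′ = toward p z
      step-to-p : z ~ z′ × d z p ≡ suc (d z′ p)
      step-to-p = toward-step (subst (0 <_) (sym zp) (s≤s z≤n))
      z′p : d z′ p ≡ ℓ
      z′p = suc-injective (trans (sym (proj₂ step-to-p)) zp)
      z′p<z′q : d z′ p < d z′ q
      z′p<z′q = ≤-pred (≤-trans (subst (λ x → suc x ≤ d z q) (proj₂ step-to-p) zp<zq)
                                (d-adjacent q (proj₁ step-to-p)))
      z′-far : ℓ + d p w ≤ d z′ w
      z′-far = go ℓ z′p z′p<z′q
      z-z′ : d z w ≡ suc (d z′ w)
      z-z′ = beyond-edge-step p~q q<p (proj₁ step-to-p) (proj₂ step-to-p) zp<zq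
               (subst (λ x → x + d p w ≤ d z′ w) (sym z′p) z′-far)

  closer-or-beyond : ∀ {v y} w → v ~ y →
    d v w ≡ suc (d y w) ⊎ (d y w ≡ suc (d v w) × (∀ {z} → d y z < d v z → d y z + d y w ≤ d z w))
  closer-or-beyond {v} {y} w v~y with adjacent-d w v~y
  ... | inj₁ closer = inj₁ closer
  ... | inj₂ farther = inj₂ (farther , λ {z} yz<vz →
          subst (λ x → x + d y w ≤ d z w) (d-sym z y)
            (beyond-edge (~-sym v~y) (subst (d v w <_) (sym farther) ≤-refl)
              (subst₂ _<_ (d-sym y z) (d-sym v z) yz<vz)))

module RealizationProperties {n} {S : List (Vec ℤ n)} (G : Graph) (W : Fin n → Vertex G) (R : Realization G W S) where

  open GraphProperties G

  private
    V : Set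
    V = Vertex G

  rep : V → Vec ℤ n
  rep u = tabulate λ i → + d u (W i)

  lookup-rep : ∀ u i → lookup (rep u) i ≡ + d u (W i)
  lookup-rep u = lookup∘tabulate _

  rep-ext : ∀ {x u} → (∀ i → lookup x i ≡ + d u (W i)) → x ≡ rep u
  rep-ext coords = Pointwise-≡⇒≡ (ext λ i → trans (coords i) (sym (lookup-rep _ i)))

  Rep⇒≡rep : ∀ {u x} → Rep G W u x → x ≡ rep u
  Rep⇒≡rep {u} {x} r = rep-ext {x} λ i → let (k , x≡k , dist) = r i in trans x≡k (cong +_ (sym (Dist⇒d dist)))

  Rep-rep : ∀ u → Rep G W u (rep u)
  Rep-rep u i = d u (W i) , lookup-rep u i , d-Dist u (W i)

  rep∈S : ∀ u → rep u ∈ S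
  rep∈S u with proj₁ (proj₂ (proj₂ R)) u
  ... | x , x∈S , r = subst (_∈ S) (Rep⇒≡rep r) x∈S

  ∈S⇒rep : ∀ {x} → x ∈ S → ∃[ u ] x ≡ rep u
  ∈S⇒rep x∈S with proj₂ (proj₂ (proj₂ R)) _ x∈S
  ... | u , r = u , Rep⇒≡rep r

  rep-injective : ∀ {u v} → rep u ≡ rep v → u ≡ v
  rep-injective {u} {v} eq = proj₁ (proj₂ R) u v (rep u) (Rep-rep u) (subst (Rep G W v) (sym eq) (Rep-rep v))

  ∣rep-rep∣ : ∀ u v i → ℤ.∣ lookup (rep u) i ℤ.- lookup (rep v) i ∣ ≡ ∣ d u (W i) - d v (W i) ∣
  ∣rep-rep∣ u v i = trans (cong₂ (λ a b → ℤ.∣ a ℤ.- b ∣) (lookup-rep u i) (lookup-rep v i))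
                          (∣+m-+n∣≡∣m-n∣ (d u (W i)) (d v (W i)))

  dist∞-rep≡1⇒ : ∀ {u v} → dist∞ (rep u) (rep v) ≡ 1 → ∀ i → ∣ d u (W i) - d v (W i) ∣ ≤ 1
  dist∞-rep≡1⇒ {u} {v} eq i =
    subst (_≤ 1) (∣rep-rep∣ u v i) (≤-trans (coordinate≤dist∞ (rep u) (rep v) i) (≤-reflexive eq))

  dist∞-rep≡1 : ∀ {u v} → Fin n → (∀ i → ∣ d u (W i) - d v (W i) ∣ ≡ 1) → dist∞ (rep u) (rep v) ≡ 1
  dist∞-rep≡1 {u} {v} j ones = ≤-antisym
    (dist∞≤ (rep u) (rep v) (λ i → ≤-reflexive (trans (∣rep-rep∣ u v i) (ones i))))
    (subst (_≤ dist∞ (rep u) (rep v)) (trans (∣rep-rep∣ u v j) (ones j)) (coordinate≤dist∞ (rep u) (rep v) j))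

  pred-coordinate : ∀ {u v} i → lookup (rep v) i ≡ lookup (rep u) i ℤ.- + 1 ⇔ d u (W i) ≡ suc (d v (W i))
  pred-coordinate {u} {v} i = mk⇔
    (λ eq → +m≡+n-1⇒n≡1+m _ (trans (sym (lookup-rep v i)) (trans eq (cong (ℤ._- + 1) (lookup-rep u i)))))
    (λ eq → trans (lookup-rep v i) (sym (trans (cong (ℤ._- + 1) (trans (lookup-rep u i) (cong +_ eq))) (+[1+n]-1≡+n _))))


  rep-cong : ∀ {u v} → (∀ i → d u (W i) ≡ d v (W i)) → rep u ≡ rep v
  rep-cong {u} eq = rep-ext λ i → trans (lookup-rep u i) (cong +_ (eq i))

  minusOne-rep : ∀ {u v} → minusOne (rep u) ≡ rep v ⇔ (∀ i → d u (W i) ≡ suc (d v (W i)))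
  minusOne-rep {u} {v} = mk⇔
    (λ eq i → Equivalence.to (pred-coordinate i)
                (trans (cong (λ x → lookup x i) (sym eq)) (lookup-map i (ℤ._- + 1) (rep u))))
    (λ drops → Pointwise-≡⇒≡ (ext λ i →
                trans (lookup-map i (ℤ._- + 1) (rep u)) (sym (Equivalence.from (pred-coordinate i) (drops i)))))

  InS₁-rep : ∀ {u} → InS₁ S (rep u) ⇔ (∃[ v ] ∀ i → d u (W i) ≡ suc (d v (W i)))
  InS₁-rep {u} = mk⇔
    (λ (_ , m∈S) → let (v , eq) = ∈S⇒rep m∈S in v , Equivalence.to minusOne-rep eq)
    (λ (v , drops) → rep∈S u , subst (_∈ S) (sym (Equivalence.from minusOne-rep drops)) (rep∈S v))

module Necessity {n} {S : List (Vec ℤ n)} (T : Graph) (W : Fin n → Vertex T)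
                 (tree : IsTree T) (R : Realization T W S) where

  open GraphProperties T
  open TreeDistance T tree
  open RealizationProperties T W R

  adjacent⇒dist∞≡1 : ∀ {u v} → Fin n → u ~ v → dist∞ (rep u) (rep v) ≡ 1
  adjacent⇒dist∞≡1 j u~v = dist∞-rep≡1 j (λ i → adjacent⇒∣m-n∣≡1 (adjacent-d (W i) u~v))

  condI : CondI S
  condI x y x∈S y∈S x-y j same with ∈S⇒rep x∈S | ∈S⇒rep y∈S
  ... | u , refl | v , refl = 0≢1 (trans (sym (dist∞-self (rep u))) (trans (cong (dist∞ (rep u)) (rep-cong equal)) x-y))
    where
    0≢1 : 0 ≢ 1
    0≢1 ()
    equal-j : d u (W j) ≡ d v (W j)
    equal-j = ℤ.+-injective (trans (sym (lookup-rep u j)) (trans same (lookup-rep v j)))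
    equal : ∀ i → d u (W i) ≡ d v (W i)
    equal i = ∣m-n∣≤1∧parity⇒≡ (dist∞-rep≡1⇒ x-y i) (parity-cancelʳ {d u (W i)} {d v (W i)} (d u (W j))
      (trans (parity-d u (W i) (W j)) (trans (sym (parity-d v (W i) (W j))) (cong (λ k → parity (d v (W i) + k)) (sym equal-j)))))

  module Predecessor {v : Vertex T} (v∉S₁ : ¬ InS₁ S (rep v)) (j : Fin n) (0<v : 0 < d v (W j)) where

    y : Vertex T
    y = toward (W j) v

    v~y : v ~ y
    v~y = proj₁ (toward-step 0<v)

    v-y : d v (W j) ≡ suc (d y (W j))
    v-y = proj₂ (toward-step 0<v)

    not-all-closer : ∀ {u} → v ~ u →
      (∀ i → ¬ (d u (W i) ≡ suc (d v (W i)) × (∀ {z} → d u z < d v z → d u z + d u (W i) ≤ d z (W i)))) → ⊥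
    not-all-closer v~u beyond-absurd = v∉S₁ (Equivalence.from InS₁-rep (_ , λ i →
      [ (λ closer → closer) , (λ beyond → ⊥-elim (beyond-absurd i beyond)) ]′ (closer-or-beyond (W i) v~u)))

    below-y-absurd : ∀ z → (∀ i → d y (W i) ≡ suc (d z (W i))) → d v z ≡ suc (d y z) ⊎ d y z ≡ suc (d v z) → ⊥
    below-y-absurd z y-z (inj₁ v-y-z) = not-all-closer v~y λ i (_ , beyond) →
      1+n≰n (≤-trans (subst (_≤ d y z + d y (W i)) (y-z i) (m≤n+m (d y (W i)) (d y z)))
                     (beyond (subst (d y z <_) (sym v-y-z) ≤-refl)))
    below-y-absurd z y-z (inj₂ y-v-z) with closer-or-beyond (W j) (~-sym v~y)
    ... | inj₁ y-v = m≢1+n+m (d y (W j)) (trans y-v (cong suc v-y))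
    ... | inj₂ (_ , beyond) =
      1+n≰n (≤-trans (≤-trans (n≤1+n _) (≤-reflexive (sym (trans v-y (cong suc (y-z j))))))
        (≤-trans (m≤n+m (d v (W j)) (d v z)) (beyond (subst (d v z <_) (sym y-v-z) ≤-refl))))

    y∈S₀ : InS₀ S (rep y)
    y∈S₀ = rep∈S y , λ y∈S₁ → let (z , y-z) = Equivalence.to InS₁-rep y∈S₁ in
      below-y-absurd z y-z (adjacent-d z v~y)

    y-unique : ∀ {t} → d v (W j) ≡ suc (d t (W j)) → (∀ i → d t (W i) ≤ suc (d v (W i))) → t ≡ y
    y-unique {t} v-t near = by-distance (d v t) refl
      where
      by-distance : ∀ m → d v t ≡ m → t ≡ y
      by-distance zero vt with d≡0⇒≡ vt
      ... | refl = ⊥-elim (1+n≢n (sym v-t))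
      by-distance (suc zero) vt = closer-neighbour-unique (W j) (d≡1⇒~ vt) v~y v-t v-y
      by-distance (suc (suc e)) vt = ⊥-elim (not-all-closer (proj₁ step-to-t) λ i (farther , beyond) →
          1+n≰n (≤-trans (+-monoˡ-≤ (d u (W i)) 1≤ut)
                (≤-trans (beyond (subst (d u t <_) (sym (proj₂ step-to-t)) ≤-refl))
                         (≤-trans (near i) (≤-reflexive (sym farther))))))
        where
        u : Vertex T
        u = toward t v
        step-to-t : v ~ u × d v t ≡ suc (d u t)
        step-to-t = toward-step (subst (0 <_) (sym vt) (s≤s z≤n))
        1≤ut : 1 ≤ d u t
        1≤ut = subst (1 ≤_) (sym (suc-injective (trans (sym (proj₂ step-to-t)) vt))) (s≤s z≤n)

  condII : CondII S
  condII x (x∈S , x∉S₁) j pos with ∈S⇒rep x∈S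
  ... | v , refl = rep y , (y∈S₀ , adjacent⇒dist∞≡1 j v~y , Equivalence.from (pred-coordinate j) v-y) , unique
    where
    open Predecessor x∉S₁ j (ℤ.drop‿+<+ (subst (+ 0 ℤ.<_) (lookup-rep v j) pos))
    unique : ∀ z → InS₀ S z → dist∞ (rep v) z ≡ 1 → lookup z j ≡ lookup (rep v) j ℤ.- + 1 → z ≡ rep y
    unique z (z∈S , _) v-z zj with ∈S⇒rep z∈S
    ... | t , refl = cong rep (y-unique (Equivalence.to (pred-coordinate j) zj) λ i →
      ∣m-n∣≤1⇒m≤1+n (subst (_≤ 1) (∣-∣-comm (d v (W i)) (d t (W i))) (dist∞-rep≡1⇒ v-z i)))

module Sufficiency {n} {S : List (Vec ℤ (suc n))} (G : Graph) (W : Fin (suc n) → Vertex G)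
                   (R : Realization G W S) (condI : CondI S) (condII : CondII S) where

  open GraphProperties G
  open RealizationProperties G W R

  open DecMembership (≡-dec {n = suc n} ℤ._≟_) using (_∈?_)

  private
    V : Set
    V = Vertex G

  ParentVec : Vec ℤ (suc n) → Vec ℤ (suc n) → Set
  ParentVec x y = y ≡ minusOne x ⊎ (InS₀ S x × InS₀ S y × dist∞ x y ≡ 1 × lookup y zero ≡ lookup x zero ℤ.- + 1)

  Parent : V → V → Set
  Parent u p = ParentVec (rep u) (rep p)

  Parent? : ∀ u p → Dec (Parent u p)
  Parent? u p = ≡-dec ℤ._≟_ (rep p) (minusOne (rep u))
          ⊎-dec InS₀? (rep u) ×-dec InS₀? (rep p) ×-dec dist∞ (rep u) (rep p) ℕ.≟ 1
                ×-dec lookup (rep p) zero ℤ.≟ lookup (rep u) zero ℤ.- + 1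
    where
    InS₀? : ∀ x → Dec (InS₀ S x)
    InS₀? x = x ∈? S ×-dec ¬? (x ∈? S ×-dec minusOne x ∈? S)

  pot : V → ℕ
  pot u = d u (W zero)

  parent-pot : ∀ {u p} → Parent u p → pot u ≡ suc (pot p)
  parent-pot (inj₁ p≡u-1)              = Equivalence.to minusOne-rep (sym p≡u-1) zero
  parent-pot (inj₂ (_ , _ , _ , p₀))   = Equivalence.to (pred-coordinate zero) p₀

  parent-near : ∀ {u p} → Parent u p → ∀ i → ∣ d u (W i) - d p (W i) ∣ ≤ 1
  parent-near (inj₁ p≡u-1) i           =
    ≤-reflexive (adjacent⇒∣m-n∣≡1 (inj₁ (Equivalence.to minusOne-rep (sym p≡u-1) i)))
  parent-near (inj₂ (_ , _ , u-p , _)) = dist∞-rep≡1⇒ u-p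

  parent-unique : ∀ {u p q} → Parent u p → Parent u q → p ≡ q
  parent-unique (inj₁ p≡) (inj₁ q≡) = rep-injective (trans p≡ (sym q≡))
  parent-unique {u} {p} (inj₁ p≡) (inj₂ (u∈S₀ , _)) =
    ⊥-elim (proj₂ u∈S₀ (rep∈S u , subst (_∈ S) p≡ (rep∈S p)))
  parent-unique {u} {q = q} (inj₂ (u∈S₀ , _)) (inj₁ q≡) =
    ⊥-elim (proj₂ u∈S₀ (rep∈S u , subst (_∈ S) q≡ (rep∈S q)))
  parent-unique {u} {p} {q} P@(inj₂ (u∈S₀ , p∈S₀ , u-p , p₀)) (inj₂ (_ , q∈S₀ , u-q , q₀)) =
    rep-injective (trans (unique (rep p) p∈S₀ u-p p₀) (sym (unique (rep q) q∈S₀ u-q q₀)))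
    where
    pos : + 0 ℤ.< lookup (rep u) zero
    pos = subst (+ 0 ℤ.<_) (sym (lookup-rep u zero)) (ℤ.+<+ (subst (0 <_) (sym (parent-pot P)) (s≤s z≤n)))
    y : Vec ℤ (suc n)
    y = proj₁ (condII (rep u) u∈S₀ zero pos)
    unique : ∀ z → InS₀ S z → dist∞ (rep u) z ≡ 1 → lookup z zero ≡ lookup (rep u) zero ℤ.- + 1 → z ≡ y
    unique = proj₂ (proj₂ (condII (rep u) u∈S₀ zero pos))

  Edge : V → V → Set
  Edge u v = Parent u v ⊎ Parent v u

  parent-step-S₀ : ∀ {u j k} → InS₀ S (rep u) → d u (W j) ≡ suc k →
                   ∃[ t ] Edge u t × d t (W j) ≡ k
  parent-step-S₀ {u} {j} {k} u∈S₀ u-k with condII (rep u) u∈S₀ j pos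
    where
    pos : + 0 ℤ.< lookup (rep u) j
    pos = subst (+ 0 ℤ.<_) (sym (lookup-rep u j)) (ℤ.+<+ (subst (0 <_) (sym u-k) (s≤s z≤n)))
  ... | y , (y∈S₀ , u-y , yⱼ) , _ with ∈S⇒rep (proj₁ y∈S₀)
  ...   | t , refl = t , orient (∣m-n∣≤1⇒adjacent (dist∞-rep≡1⇒ u-y zero) pot≢) ,
                     suc-injective (trans (sym (Equivalence.to (pred-coordinate j) yⱼ)) u-k)
    where
    pot≢ : pot u ≢ pot t
    pot≢ eq = condI (rep u) (rep t) (rep∈S u) (rep∈S t) u-y zero
                (trans (lookup-rep u zero) (trans (cong +_ eq) (sym (lookup-rep t zero))))
    orient : pot u ≡ suc (pot t) ⊎ pot t ≡ suc (pot u) → Edge u t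
    orient (inj₁ down) = inj₁ (inj₂ (u∈S₀ , y∈S₀ , u-y , Equivalence.from (pred-coordinate zero) down))
    orient (inj₂ up)   = inj₂ (inj₂ (y∈S₀ , u∈S₀ , trans (dist∞-sym (rep t) (rep u)) u-y ,
                                      Equivalence.from (pred-coordinate zero) up))

  parent-step : ∀ {u j k} → d u (W j) ≡ suc k → ∃[ t ] Edge u t × d t (W j) ≡ k
  parent-step {u} {j} u-k with minusOne (rep u) ∈? S
  ... | yes u-1∈S = let (v , u-1≡v) = ∈S⇒rep u-1∈S in
    v , inj₁ (inj₁ (sym u-1≡v)) , suc-injective (trans (sym (Equivalence.to minusOne-rep u-1≡v j)) u-k)
  ... | no u-1∉S = parent-step-S₀ (rep∈S u , u-1∉S ∘ proj₂) u-k

  edge-near : ∀ {u v} → Edge u v → ∀ i → d u (W i) ≤ suc (d v (W i))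
  edge-near (inj₁ u→v) i = ∣m-n∣≤1⇒m≤1+n (parent-near u→v i)
  edge-near {u} {v} (inj₂ v→u) i =
    ∣m-n∣≤1⇒m≤1+n (subst (_≤ 1) (∣-∣-comm (d v (W i)) (d u (W i))) (parent-near v→u i))

  no-self-parent : ∀ {u} → ¬ Parent u u
  no-self-parent p = 1+n≰n (≤-reflexive (sym (parent-pot p)))

  adjT : V → V → Bool
  adjT u v = does (Parent? u v ⊎-dec Parent? v u)

  adjT-sym : ∀ u v → adjT u v ≡ adjT v u
  adjT-sym u v = ∨-comm (does (Parent? u v)) (does (Parent? v u))

  adjT⇒Edge : ∀ {u v} → adjT u v ≡ true → Edge u v
  adjT⇒Edge {u} {v} = does≡true⇒ (Parent? u v ⊎-dec Parent? v u)

  walkT : ∀ {k u} i → d u (W i) ≡ k → Walk adjT u (W i) k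
  walkT {zero}  i u-0 = subst (λ x → Walk adjT x (W i) 0) (sym (d≡0⇒≡ u-0)) here
  walkT {suc k} i u-k with parent-step u-k
  ... | t , edge , t-k = step (dec-true (Parent? _ t ⊎-dec Parent? t _) edge) (walkT i t-k)

  walkT-length : ∀ {u i ℓ} → Walk adjT u (W i) ℓ → d u (W i) ≤ ℓ
  walkT-length {i = i} here   = ≤-reflexive (d-self (W i))
  walkT-length {i = i} (step e p) = ≤-trans (edge-near (adjT⇒Edge e) i) (s≤s (walkT-length p))

  T : Graph
  T = record
    { m         = m G
    ; nonempty  = nonempty G
    ; adj       = adjT
    ; irrefl    = λ u → dec-false (Parent? u u ⊎-dec Parent? u u) [ no-self-parent , no-self-parent ]′
    ; sym       = adjT-sym
    ; connected = λ u v → _ , (walkT zero refl ++ʷ reverseʷ adjT-sym (walkT zero refl))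
    }

  T-Dist : ∀ u i → Dist T u (W i) (d u (W i))
  T-Dist u i = walkT i refl , λ _ → walkT-length

  T-tree : IsTree T
  T-tree = GraphProperties.ranked-parents⇒IsTree T Parent pot adjT⇒Edge
             (λ p → subst (_ <_) (sym (parent-pot p)) ≤-refl) parent-unique

  T-realization : Realization T W S
  T-realization = proj₁ R , resolving , (λ u → rep u , rep∈S u , RepG⇒RepT {u} {rep u} (Rep-rep u)) ,
                  λ x x∈S → let (u , x≡u) = ∈S⇒rep x∈S in
                    u , subst (Rep T W u) (sym x≡u) (RepG⇒RepT {u} {rep u} (Rep-rep u))
    where
    RepG⇒RepT : ∀ {u x} → Rep G W u x → Rep T W u x
    RepG⇒RepT {u} r i = let (k , x≡k , dist) = r i in k , x≡k , subst (Dist T u (W i)) (Dist⇒d dist) (T-Dist u i)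
    RepT⇒RepG : ∀ {u x} → Rep T W u x → Rep G W u x
    RepT⇒RepG {u} r i = let (k , x≡k , dist) = r i in
      k , x≡k , subst (Dist G u (W i)) (GraphProperties.Dist-unique T (T-Dist u i) dist) (d-Dist u (W i))
    resolving : Resolving T W
    resolving u v x ru rv = proj₁ (proj₂ R) u v x (RepT⇒RepG {u} {x} ru) (RepT⇒RepG {v} {x} rv)

-- Without landmarks, resolvability forces a single vertex.
no-landmarks⇒IsTree : ∀ {G : Graph} {W : Fin 0 → Vertex G} → Resolving G W → IsTree G
no-landmarks⇒IsTree {G} resolving (_ , f , f-injective , _)
  with f-injective (resolving (f zero) (f (suc zero)) [] (λ ()) (λ ()))
... | ()

tree-realization : ∀ {n} {S : List (Vec ℤ n)} {G : Graph} {W : Fin n → Vertex G} →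
  Realization G W S → CondI S → CondII S → ∃[ T ] Σ (Fin n → Vertex T) λ W → IsTree T × Realization T W S
tree-realization {zero}  {G = G} {W} R _ _ = G , W , no-landmarks⇒IsTree {G} {W} (proj₁ (proj₂ R)) , R
tree-realization {suc n} {G = G} {W} R condI condII = T , W , T-tree , T-realization
  where open Sufficiency G W R condI condII

theorem4p3 : ∀ (n : ℕ) (S : List (Vec ℤ n)) → Realizable S →
    ((∃[ T ] Σ (Fin n → Vertex T) λ W → IsTree T × Realization T W S)
      ⇔ (CondI S × CondII S))
theorem4p3 n S (G , W , R) = mk⇔
  (λ (T , W′ , tree , R′) → Necessity.condI T W′ tree R′ , Necessity.condII T W′ tree R′)
  (λ (condI , condII) → tree-realization {S = S} {G} {W} R condI condII)
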